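{- Let $g\ge1$ and $n\ge1$ with $\gcd(g+1,2^n-1)=1$. Let $C_1,C_2$ be isomorphic hyperelliptic curves of genus $g$ over $\mathbb{F}_{2^n}$ given by $y^2+v(x)y=u_i(x)$ ($i=1,2$) with the same $v$ and $\max(2\deg v,\deg u_i)\in\{2g+1,2g+2\}$. Then there exist $A\in\mathrm{Stab}_{v}$ and $r\in\mathbb{F}_{2^n}[t]/(t^{g+2})$ (i.e. a polynomial of degree at most $g+1$) such that $$u_2(x)=\psi_{2g+2}(A)\big(u_1(x)+r(x)^2+v(x)r(x)\big).$$
   Context: For $A=\begin{pmatrix}a&b\\c&d\end{pmatrix}\in\mathrm{GL}_2(\mathbb{F}_{2^n})$ and $f$ of degree at most $m$, $\psi_m(A)(f)(x)=(cx+d)^m f\!\left(\frac{ax+b}{cx+d}\right)$. $\mathrm{Stab}_v=\{A\in\mathrm{GL}_2(\mathbb{F}_{2^n}):\psi_{g+1}(A)(v)=v\}$. -}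

module Defs where

open import Data.Nat using (ℕ; zero; suc; _+_; _^_; _<_; _∸_)
open import Data.Fin using (Fin)
open import Data.List using (List; []; _∷_)
open import Data.Product using (Σ; _×_; _,_; ∃)
open import Relation.Binary.PropositionalEquality using (_≡_)
open import Relation.Nullary using (¬_)
open import Function.Bundles using (_↔_)
open import Algebra.Structures using (IsCommutativeRing)

-- A finite field with exactly 2^n elements (i.e. a model of F_{2^n};
-- all such fields are isomorphic).  Equality is propositional.
record GF2^ (n : ℕ) : Set₁ where
  infixl 6 _+ᶠ_
  infixl 7 _*ᶠ_
  field
    Carrier : Set
    _+ᶠ_ _*ᶠ_ : Carrier → Carrier → Carrier
    -ᶠ_     : Carrier → Carrier
    0# 1#   : Carrier
    isCommutativeRing : IsCommutativeRing _≡_ _+ᶠ_ _*ᶠ_ -ᶠ_ 0# 1#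
    0≢1     : ¬ (0# ≡ 1#)
    inverse : (x : Carrier) → ¬ (x ≡ 0#) → Σ Carrier (λ y → x *ᶠ y ≡ 1#)
    card    : Carrier ↔ Fin (2 ^ n)

-- Polynomials over F as coefficient lists (constant term first),
-- compared coefficientwise (trailing zeros are irrelevant).
module Poly {n : ℕ} (F : GF2^ n) where
  open GF2^ F public

  Pol : Set
  Pol = List Carrier

  coeff : Pol → ℕ → Carrier
  coeff []       _       = 0#
  coeff (a ∷ p)  zero    = a
  coeff (a ∷ p)  (suc k) = coeff p k

  _≈ₚ_ : Pol → Pol → Set
  p ≈ₚ q = ∀ k → coeff p k ≡ coeff q k

  -- deg p ≤ m  (the zero polynomial has degree ≤ m for every m)
  DegLe : Pol → ℕ → Set
  DegLe p m = ∀ k → m < k → coeff p k ≡ 0#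

  infixl 6 _⊕_
  infixl 7 _⊗_ _·_

  _⊕_ : Pol → Pol → Pol
  []      ⊕ q       = q
  (a ∷ p) ⊕ []      = a ∷ p
  (a ∷ p) ⊕ (b ∷ q) = (a +ᶠ b) ∷ (p ⊕ q)

  _·_ : Carrier → Pol → Pol
  c · []      = []
  c · (a ∷ p) = (c *ᶠ a) ∷ (c · p)

  _⊗_ : Pol → Pol → Pol
  []      ⊗ q = []
  (a ∷ p) ⊗ q = (a · q) ⊕ (0# ∷ (p ⊗ q))

  _^ₚ_ : Pol → ℕ → Pol
  p ^ₚ zero  = 1# ∷ []
  p ^ₚ suc k = p ⊗ (p ^ₚ k)

  record GL2 : Set where
    constructor mat
    field
      a b c d : Carrier
      det≢0 : ¬ (a *ᶠ d +ᶠ -ᶠ (b *ᶠ c) ≡ 0#)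

  -- ψ_m(A)(f)(x) = (cx+d)^m f((ax+b)/(cx+d))
  --             = Σ_{k=0}^{m} f_k (ax+b)^k (cx+d)^(m-k)     (deg f ≤ m)
  ψ : ℕ → GL2 → Pol → Pol
  ψ m A f = go m
    where
    open GL2 A
    term : ℕ → Pol
    term k = coeff f k · (((b ∷ a ∷ []) ^ₚ k) ⊗ ((d ∷ c ∷ []) ^ₚ (m ∸ k)))
    go : ℕ → Pol
    go zero    = term zero
    go (suc k) = term (suc k) ⊕ go k

  Stab : ℕ → Pol → GL2 → Set
  Stab g v A = ψ (suc g) A v ≈ₚ v

  -- max(2 deg v, deg u) ∈ {2g+1, 2g+2}
  DegCond : ℕ → Pol → Pol → Set
  DegCond g v u = DegLe v (suc g) × DegLe u (suc (suc (g + g)))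
                × ¬ (DegLe v g × DegLe u (g + g))

  -- Isomorphism of the genus-g hyperelliptic curves
  --   C : y² + v(x) y = u(x)  and  C' : y² + v'(x) y = u'(x)
  -- via an admissible change of variables
  --   x ↦ (ax+b)/(cx+d),  y ↦ (e y + h(x)) / (cx+d)^{g+1},
  -- A = (a b ; c d) ∈ GL_2, e ≠ 0, deg h ≤ g+1, which turns the equation of C
  -- into that of C':  e v' = ψ_{g+1}(A)(v),
  --                   e² u' = ψ_{2g+2}(A)(u) + h² + ψ_{g+1}(A)(v) h.
  Isomorphic : ℕ → Pol → Pol → Pol → Pol → Set
  Isomorphic g v u v' u' =
    Σ GL2 λ A → Σ Carrier λ e → Σ Pol λ h →
      ¬ (e ≡ 0#) × DegLe h (suc g)
      × (e · v') ≈ₚ ψ (suc g) A v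
      × ((e *ᶠ e) · u') ≈ₚ (ψ (suc (suc (g + g))) A u ⊕ (h ⊗ h) ⊕ (ψ (suc g) A v ⊗ h))

-- As g + 1 is prime to 2ⁿ - 1, Bézout and
-- Fermat's little theorem give l with l^{g+1} e = 1.  Since ψ_m(l A) = l^m ψ_m(A),
-- replacing A by l A and h by l^{g+1} h turns e into 1, so that l A ∈ Stab_v.  Next,
-- ψ_m(A) ∘ ψ_m(adj A) is multiplication by det(A)^m, so h = ψ_{g+1}(l A)(r) for some
-- r of degree ≤ g + 1; as ψ is multiplicative, h² + v h = ψ_{2g+2}(l A)(r² + v r).
module Submission where

open import Defs
open import Data.Nat using (ℕ; zero; suc; _+_; _*_; _^_; _∸_; _≤_; pred; z≤n; s≤s)
import Data.Nat.Properties as ℕ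
open import Data.Nat.GCD using (gcd; module Bézout)
open import Data.Nat.Coprimality using (gcd≡1⇒coprime; coprime-Bézout)
open import Data.Fin as Fin using (Fin; punchIn)
open import Data.Fin.Properties using (inj⇒≟; punchInᵢ≢i)
open import Data.Fin.Permutation using (Permutation′)
open import Data.List using ([]; _∷_)
open import Data.Product using (Σ; ∃; _×_; _,_; proj₁; proj₂)
open import Function using (_∘_; Inverse; mk↔ₛ′)
open import Function.Properties.Inverse using (↔⇒↣)
open import Function.Construct.Composition using (_↔-∘_)
open import Function.Construct.Symmetry using (↔-sym)
open import Relation.Binary.PropositionalEquality
open import Relation.Nullary using (Dec; yes; no; contradiction)
open import Algebra.Bundles using (CommutativeRing; CommutativeMonoid)
import Algebra.Properties.Ring as RingProperties
import Algebra.Properties.CommutativeSemigroup as CommutativeSemigroupProperties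
import Algebra.Properties.CommutativeSemiring.Exp as ExpProperties
import Algebra.Properties.CommutativeMonoid.Sum as ProductProperties
open import Relation.Binary.Structures using (IsEquivalence)
open import Relation.Binary.Bundles using (Setoid)
import Relation.Binary.Reasoning.Setoid as SetoidReasoning

module FiniteField {n : ℕ} (F : GF2^ n) where
  open GF2^ F using (Carrier; _+ᶠ_; _*ᶠ_; -ᶠ_; 0#; 1#; isCommutativeRing; 0≢1; inverse; card)

  commutativeRing : CommutativeRing _ _
  commutativeRing = record { isCommutativeRing = isCommutativeRing }

  open CommutativeRing commutativeRing public
    using ( +-assoc; +-comm; +-identityˡ; +-identityʳ; -‿inverseˡ
          ; *-assoc; *-comm; *-identityˡ; *-identityʳ; zeroˡ; zeroʳ; distribˡ; distribʳ
          ; _-_; *-commutativeSemigroup)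
  open RingProperties (CommutativeRing.ring commutativeRing) public using (-‿distribˡ-*; x[y-z]≈xy-xz)
  open CommutativeSemigroupProperties *-commutativeSemigroup public using (interchange)
  open ExpProperties (CommutativeRing.commutativeSemiring commutativeRing) public
    using (^-homo-*; ^-assocʳ; ^-distrib-*) renaming (_^_ to _^ᶠ_)
  open ProductProperties (CommutativeRing.*-commutativeMonoid commutativeRing)
    using (∑-permute; ∑-distrib-+; sum-remove; sum-replicate; sum-cong-≗)
    renaming (sum to ∏)

  open ≡-Reasoning

  1≢0 : 1# ≢ 0#
  1≢0 = 0≢1 ∘ sym

  _⁻¹⟨_⟩ : (x : Carrier) → x ≢ 0# → Carrier
  x ⁻¹⟨ x≢0 ⟩ = proj₁ (inverse x x≢0)

  ⁻¹-inverseʳ : ∀ {x} (x≢0 : x ≢ 0#) → x *ᶠ x ⁻¹⟨ x≢0 ⟩ ≡ 1#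
  ⁻¹-inverseʳ {x} x≢0 = proj₂ (inverse x x≢0)

  ⁻¹-inverseˡ : ∀ {x} (x≢0 : x ≢ 0#) → x ⁻¹⟨ x≢0 ⟩ *ᶠ x ≡ 1#
  ⁻¹-inverseˡ {x} x≢0 = trans (*-comm _ x) (⁻¹-inverseʳ x≢0)

  x⁻¹[xy]≡y : ∀ {x} (x≢0 : x ≢ 0#) y → x ⁻¹⟨ x≢0 ⟩ *ᶠ (x *ᶠ y) ≡ y
  x⁻¹[xy]≡y {x} x≢0 y = begin
    x ⁻¹⟨ x≢0 ⟩ *ᶠ (x *ᶠ y)  ≡⟨ *-assoc _ x y ⟨
    x ⁻¹⟨ x≢0 ⟩ *ᶠ x *ᶠ y    ≡⟨ cong (_*ᶠ y) (⁻¹-inverseˡ x≢0) ⟩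
    1# *ᶠ y                  ≡⟨ *-identityˡ y ⟩
    y                        ∎

  x[x⁻¹y]≡y : ∀ {x} (x≢0 : x ≢ 0#) y → x *ᶠ (x ⁻¹⟨ x≢0 ⟩ *ᶠ y) ≡ y
  x[x⁻¹y]≡y {x} x≢0 y = begin
    x *ᶠ (x ⁻¹⟨ x≢0 ⟩ *ᶠ y)  ≡⟨ *-assoc x _ y ⟨
    x *ᶠ x ⁻¹⟨ x≢0 ⟩ *ᶠ y    ≡⟨ cong (_*ᶠ y) (⁻¹-inverseʳ x≢0) ⟩
    1# *ᶠ y                  ≡⟨ *-identityˡ y ⟩
    y                        ∎

  ⁻¹≢0 : ∀ {x} (x≢0 : x ≢ 0#) → x ⁻¹⟨ x≢0 ⟩ ≢ 0#
  ⁻¹≢0 {x} x≢0 x⁻¹≡0 = 1≢0 (begin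
    1#                   ≡⟨ ⁻¹-inverseʳ x≢0 ⟨
    x *ᶠ x ⁻¹⟨ x≢0 ⟩     ≡⟨ cong (x *ᶠ_) x⁻¹≡0 ⟩
    x *ᶠ 0#              ≡⟨ zeroʳ x ⟩
    0#                   ∎)

  *-cancelˡ : ∀ {x y z} → x ≢ 0# → x *ᶠ y ≡ x *ᶠ z → y ≡ z
  *-cancelˡ {x} {y} {z} x≢0 xy≡xz = begin
    y                          ≡⟨ x⁻¹[xy]≡y x≢0 y ⟨
    x ⁻¹⟨ x≢0 ⟩ *ᶠ (x *ᶠ y)    ≡⟨ cong (x ⁻¹⟨ x≢0 ⟩ *ᶠ_) xy≡xz ⟩
    x ⁻¹⟨ x≢0 ⟩ *ᶠ (x *ᶠ z)    ≡⟨ x⁻¹[xy]≡y x≢0 z ⟩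
    z                          ∎

  *-cancelʳ : ∀ {x y z} → x ≢ 0# → y *ᶠ x ≡ z *ᶠ x → y ≡ z
  *-cancelʳ {x} {y} {z} x≢0 yx≡zx = *-cancelˡ x≢0 (trans (*-comm x y) (trans yx≡zx (*-comm z x)))

  *-≢0 : ∀ {x y} → x ≢ 0# → y ≢ 0# → x *ᶠ y ≢ 0#
  *-≢0 {x} {y} x≢0 y≢0 xy≡0 = y≢0 (*-cancelˡ x≢0 (trans xy≡0 (sym (zeroʳ x))))

  1^n≡1 : ∀ k → 1# ^ᶠ k ≡ 1#
  1^n≡1 zero    = refl
  1^n≡1 (suc k) = trans (*-identityˡ _) (1^n≡1 k)

  x^[1+k]*y≡1⇒x≢0 : ∀ {x y} k → x ^ᶠ suc k *ᶠ y ≡ 1# → x ≢ 0#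
  x^[1+k]*y≡1⇒x≢0 {x} {y} k x^[1+k]*y≡1 refl = 0≢1 (begin
    0#                        ≡⟨ zeroˡ y ⟨
    0# *ᶠ y                   ≡⟨ cong (_*ᶠ y) (zeroˡ (0# ^ᶠ k)) ⟨
    0# ^ᶠ suc k *ᶠ y          ≡⟨ x^[1+k]*y≡1 ⟩
    1#                        ∎)

  -x*y+y*x≡0 : ∀ x y → (-ᶠ x) *ᶠ y +ᶠ y *ᶠ x ≡ 0#
  -x*y+y*x≡0 x y = trans (cong₂ _+ᶠ_ (sym (-‿distribˡ-* x y)) (*-comm y x)) (-‿inverseˡ (x *ᶠ y))

  -b*c+d*a≡ad-bc : ∀ a b c d → (-ᶠ b) *ᶠ c +ᶠ d *ᶠ a ≡ a *ᶠ d - b *ᶠ c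
  -b*c+d*a≡ad-bc a b c d =
    trans (+-comm _ _) (cong₂ _+ᶠ_ (*-comm d a) (sym (-‿distribˡ-* b c)))

  a*d+-c*b≡ad-bc : ∀ a b c d → a *ᶠ d +ᶠ (-ᶠ c) *ᶠ b ≡ a *ᶠ d - b *ᶠ c
  a*d+-c*b≡ad-bc a b c d =
    cong (a *ᶠ d +ᶠ_) (trans (sym (-‿distribˡ-* c b)) (cong -ᶠ_ (*-comm c b)))

  det-scale : ∀ l a b c d → (l *ᶠ a) *ᶠ (l *ᶠ d) - (l *ᶠ b) *ᶠ (l *ᶠ c) ≡ (l *ᶠ l) *ᶠ (a *ᶠ d - b *ᶠ c)
  det-scale l a b c d =
    trans (cong₂ _-_ (interchange l a l d) (interchange l b l c)) (sym (x[y-z]≈xy-xz (l *ᶠ l) _ _))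

  _≟_ : (x y : Carrier) → Dec (x ≡ y)
  _≟_ = inj⇒≟ (↔⇒↣ card)

  zeroToOne : Carrier → Carrier
  zeroToOne x with x ≟ 0#
  ... | yes _ = 1#
  ... | no  _ = x

  zeroToOne-≢0 : ∀ {x} → x ≢ 0# → zeroToOne x ≡ x
  zeroToOne-≢0 {x} x≢0 with x ≟ 0#
  ... | yes x≡0 = contradiction x≡0 x≢0
  ... | no  _   = refl

  zeroToOne≢0 : ∀ x → zeroToOne x ≢ 0#
  zeroToOne≢0 x with x ≟ 0#
  ... | yes _   = 1≢0
  ... | no  x≢0 = x≢0

  ∏-≢0 : ∀ {N} (G : Fin N → Carrier) → (∀ i → G i ≢ 0#) → ∏ G ≢ 0#
  ∏-≢0 {zero}  G G≢0 = 1≢0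
  ∏-≢0 {suc N} G G≢0 = *-≢0 (G≢0 Fin.zero) (∏-≢0 (G ∘ Fin.suc) (G≢0 ∘ Fin.suc))

  ∏-scale : ∀ {N} x (G : Fin N → Carrier) → ∏ (λ i → x *ᶠ G i) ≡ x ^ᶠ N *ᶠ ∏ G
  ∏-scale {N} x G = trans (∑-distrib-+ (λ _ → x) G) (cong (_*ᶠ ∏ G) (sum-replicate N))

  ∏-scaleAt : ∀ {N} x (G H : Fin N → Carrier) i → G i ≡ x *ᶠ H i → (∀ j → j ≢ i → G j ≡ H j) →
             ∏ G ≡ x *ᶠ ∏ H
  ∏-scaleAt {suc N} x G H i Gi≡xHi G≗H = begin
    ∏ G                                              ≡⟨ sum-remove G ⟩
    G i *ᶠ ∏ (G ∘ punchIn i)                         ≡⟨ cong₂ _*ᶠ_ Gi≡xHi (sum-cong-≗ (λ j → G≗H _ (punchInᵢ≢i i j))) ⟩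
    x *ᶠ H i *ᶠ ∏ (H ∘ punchIn i)                    ≡⟨ *-assoc x _ _ ⟩
    x *ᶠ (H i *ᶠ ∏ (H ∘ punchIn i))                  ≡⟨ cong (x *ᶠ_) (sum-remove H) ⟨
    x *ᶠ ∏ H                                         ∎

  open Inverse card using (to; from; strictlyInverseˡ; strictlyInverseʳ)

  *-permutation : ∀ {x} → x ≢ 0# → Permutation′ (2 ^ n)
  *-permutation {x} x≢0 = card ↔-∘ (mk↔ₛ′ (x *ᶠ_) (x ⁻¹⟨ x≢0 ⟩ *ᶠ_) (x[x⁻¹y]≡y x≢0) (x⁻¹[xy]≡y x≢0) ↔-∘ ↔-sym card)

  -- With q = 2ⁿ and P = ∏_y zeroToOne y over all of F, ∏_y x · zeroToOne y = x^q P
  -- equals x · ∏_y zeroToOne (x y), the factors differing only at y = 0; and that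
  -- is x P because y ↦ x y permutes F.  Hence x^q = x.
  fermat : ∀ {x} → x ≢ 0# → x ^ᶠ (2 ^ n ∸ 1) ≡ 1#
  fermat {x} x≢0 = *-cancelˡ x≢0 (begin
    x *ᶠ x ^ᶠ (2 ^ n ∸ 1)  ≡⟨ cong (x ^ᶠ_) 2^n≡1+[2^n∸1] ⟨
    x ^ᶠ 2 ^ n             ≡⟨ x^q≡x ⟩
    x                      ≡⟨ *-identityʳ x ⟨
    x *ᶠ 1#                ∎)
    where
    2^n≡1+[2^n∸1] : 2 ^ n ≡ suc (2 ^ n ∸ 1)
    2^n≡1+[2^n∸1] = sym (ℕ.suc-pred (2 ^ n) {{ℕ.m^n≢0 2 n}})

    P : Fin (2 ^ n) → Carrier
    P = zeroToOne ∘ from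

    ∏[x·]≡∏ : ∏ (zeroToOne ∘ (x *ᶠ_) ∘ from) ≡ ∏ P
    ∏[x·]≡∏ = trans (sum-cong-≗ λ i → cong zeroToOne (sym (strictlyInverseʳ (x *ᶠ from i))))
                    (sym (∑-permute P (*-permutation x≢0)))

    x^q≡x : x ^ᶠ 2 ^ n ≡ x
    x^q≡x = *-cancelʳ (∏-≢0 P (zeroToOne≢0 ∘ from)) (begin
      x ^ᶠ 2 ^ n *ᶠ ∏ P                       ≡⟨ ∏-scale x P ⟨
      ∏ (λ i → x *ᶠ P i)                      ≡⟨ ∏-scaleAt x _ _ (to 0#) at-0 away-from-0 ⟩
      x *ᶠ ∏ (zeroToOne ∘ (x *ᶠ_) ∘ from)     ≡⟨ cong (x *ᶠ_) ∏[x·]≡∏ ⟩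
      x *ᶠ ∏ P                                ∎)
      where
      from-0 : from (to 0#) ≡ 0#
      from-0 = strictlyInverseʳ 0#

      at-0 : x *ᶠ P (to 0#) ≡ x *ᶠ zeroToOne (x *ᶠ from (to 0#))
      at-0 = cong (λ y → x *ᶠ zeroToOne y) (trans from-0 (sym (trans (cong (x *ᶠ_) from-0) (zeroʳ x))))

      away-from-0 : ∀ i → i ≢ to 0# → x *ᶠ P i ≡ zeroToOne (x *ᶠ from i)
      away-from-0 i i≢0 = trans (cong (x *ᶠ_) (zeroToOne-≢0 from-i≢0)) (sym (zeroToOne-≢0 (*-≢0 x≢0 from-i≢0)))
        where
        from-i≢0 : from i ≢ 0#
        from-i≢0 from-i≡0 = i≢0 (trans (sym (strictlyInverseˡ i)) (cong to from-i≡0))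

  x^[k*[2^n∸1]]≡1 : ∀ {x} → x ≢ 0# → ∀ k → x ^ᶠ (k * (2 ^ n ∸ 1)) ≡ 1#
  x^[k*[2^n∸1]]≡1 {x} x≢0 k = begin
    x ^ᶠ (k * (2 ^ n ∸ 1))      ≡⟨ cong (x ^ᶠ_) (ℕ.*-comm k _) ⟩
    x ^ᶠ ((2 ^ n ∸ 1) * k)      ≡⟨ ^-assocʳ x (2 ^ n ∸ 1) k ⟨
    (x ^ᶠ (2 ^ n ∸ 1)) ^ᶠ k     ≡⟨ cong (_^ᶠ k) (fermat x≢0) ⟩
    1# ^ᶠ k                     ≡⟨ 1^n≡1 k ⟩
    1#                          ∎

  root-of-inverse : ∀ k {e} → gcd k (2 ^ n ∸ 1) ≡ 1 → e ≢ 0# → ∃ λ l → l ^ᶠ k *ᶠ e ≡ 1#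
  root-of-inverse k {e} gcd≡1 e≢0 with coprime-Bézout (gcd≡1⇒coprime gcd≡1)
  ... | Bézout.+- x y 1+y[2^n∸1]≡xk = e⁻¹ ^ᶠ x , (begin
    (e⁻¹ ^ᶠ x) ^ᶠ k *ᶠ e                  ≡⟨ cong (_*ᶠ e) (^-assocʳ e⁻¹ x k) ⟩
    e⁻¹ ^ᶠ (x * k) *ᶠ e                   ≡⟨ cong (λ j → e⁻¹ ^ᶠ j *ᶠ e) 1+y[2^n∸1]≡xk ⟨
    e⁻¹ *ᶠ e⁻¹ ^ᶠ (y * (2 ^ n ∸ 1)) *ᶠ e  ≡⟨ cong (λ z → e⁻¹ *ᶠ z *ᶠ e) (x^[k*[2^n∸1]]≡1 (⁻¹≢0 e≢0) y) ⟩
    e⁻¹ *ᶠ 1# *ᶠ e                        ≡⟨ cong (_*ᶠ e) (*-identityʳ e⁻¹) ⟩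
    e⁻¹ *ᶠ e                              ≡⟨ ⁻¹-inverseˡ e≢0 ⟩
    1#                                    ∎)
    where
    e⁻¹ = e ⁻¹⟨ e≢0 ⟩
  ... | Bézout.-+ x y 1+xk≡y[2^n∸1] = e ^ᶠ x , (begin
    (e ^ᶠ x) ^ᶠ k *ᶠ e       ≡⟨ cong (_*ᶠ e) (^-assocʳ e x k) ⟩
    e ^ᶠ (x * k) *ᶠ e        ≡⟨ *-comm _ e ⟩
    e ^ᶠ (1 + x * k)         ≡⟨ cong (e ^ᶠ_) 1+xk≡y[2^n∸1] ⟩
    e ^ᶠ (y * (2 ^ n ∸ 1))   ≡⟨ x^[k*[2^n∸1]]≡1 e≢0 y ⟩
    1#                       ∎)

module Polynomial {n : ℕ} (F : GF2^ n) where
  open Poly F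
  open FiniteField F

  infix 4 _≋_

  -- Records rather than ≈ₚ and DegLe, so that the polynomials can be inferred from the type.
  record _≋_ (p q : Pol) : Set where
    constructor ≈ₚ⇒≋
    field ≋⇒≈ₚ : p ≈ₚ q
  open _≋_ public

  record Deg≤ (p : Pol) (m : ℕ) : Set where
    constructor DegLe⇒Deg≤
    field Deg≤⇒DegLe : DegLe p m
  open Deg≤ public

  ≋-isEquivalence : IsEquivalence _≋_
  ≋-isEquivalence = record
    { refl  = ≈ₚ⇒≋ λ _ → refl
    ; sym   = λ p≋q → ≈ₚ⇒≋ λ k → sym (≋⇒≈ₚ p≋q k)
    ; trans = λ p≋q q≋r → ≈ₚ⇒≋ λ k → trans (≋⇒≈ₚ p≋q k) (≋⇒≈ₚ q≋r k)
    }

  ≋-setoid : Setoid _ _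
  ≋-setoid = record { isEquivalence = ≋-isEquivalence }

  open IsEquivalence ≋-isEquivalence public using () renaming (refl to ≋-refl; sym to ≋-sym; trans to ≋-trans)
  open SetoidReasoning ≋-setoid

  ≡⇒≋ : ∀ {p q} → p ≡ q → p ≋ q
  ≡⇒≋ refl = ≋-refl

  coeff-⊕ : ∀ p q k → coeff (p ⊕ q) k ≡ coeff p k +ᶠ coeff q k
  coeff-⊕ []      q       k       = sym (+-identityˡ _)
  coeff-⊕ (a ∷ p) []      k       = sym (+-identityʳ _)
  coeff-⊕ (a ∷ p) (b ∷ q) zero    = refl
  coeff-⊕ (a ∷ p) (b ∷ q) (suc k) = coeff-⊕ p q k

  coeff-· : ∀ c p k → coeff (c · p) k ≡ c *ᶠ coeff p k
  coeff-· c []      k       = sym (zeroʳ c)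
  coeff-· c (a ∷ p) zero    = refl
  coeff-· c (a ∷ p) (suc k) = coeff-· c p k

  ∷-cong : ∀ {a b p q} → a ≡ b → p ≋ q → a ∷ p ≋ b ∷ q
  ∷-cong a≡b p≋q = ≈ₚ⇒≋ λ { zero → a≡b ; (suc k) → ≋⇒≈ₚ p≋q k }

  0∷[]≋[] : 0# ∷ [] ≋ []
  0∷[]≋[] = ≈ₚ⇒≋ λ { zero → refl ; (suc k) → refl }

  ∷≋[]⇒head≡0 : ∀ {a p} → a ∷ p ≋ [] → a ≡ 0#
  ∷≋[]⇒head≡0 a∷p≋[] = ≋⇒≈ₚ a∷p≋[] zero

  ∷≋[]⇒tail≋[] : ∀ {a p} → a ∷ p ≋ [] → p ≋ []
  ∷≋[]⇒tail≋[] a∷p≋[] = ≈ₚ⇒≋ (≋⇒≈ₚ a∷p≋[] ∘ suc)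

  ⊕-coeffwise : ∀ p q p′ q′ → (∀ k → coeff p k +ᶠ coeff q k ≡ coeff p′ k +ᶠ coeff q′ k) → p ⊕ q ≋ p′ ⊕ q′
  ⊕-coeffwise p q p′ q′ eq = ≈ₚ⇒≋ λ k → trans (coeff-⊕ p q k) (trans (eq k) (sym (coeff-⊕ p′ q′ k)))

  ⊕-cong : ∀ {p p′ q q′} → p ≋ p′ → q ≋ q′ → p ⊕ q ≋ p′ ⊕ q′
  ⊕-cong {p} {p′} {q} {q′} p≋p′ q≋q′ = ⊕-coeffwise p q p′ q′ λ k → cong₂ _+ᶠ_ (≋⇒≈ₚ p≋p′ k) (≋⇒≈ₚ q≋q′ k)

  ⊕-comm : ∀ p q → p ⊕ q ≋ q ⊕ p
  ⊕-comm p q = ⊕-coeffwise p q q p λ k → +-comm (coeff p k) (coeff q k)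

  ⊕-assoc : ∀ p q r → (p ⊕ q) ⊕ r ≋ p ⊕ (q ⊕ r)
  ⊕-assoc p q r = ⊕-coeffwise (p ⊕ q) r p (q ⊕ r) λ k →
    trans (cong (_+ᶠ coeff r k) (coeff-⊕ p q k))
          (trans (+-assoc (coeff p k) _ _) (cong (coeff p k +ᶠ_) (sym (coeff-⊕ q r k))))

  ⊕-identityʳ : ∀ p → p ⊕ [] ≋ p
  ⊕-identityʳ p = ≈ₚ⇒≋ λ k → trans (coeff-⊕ p [] k) (+-identityʳ _)

  ⊕-commutativeMonoid : CommutativeMonoid _ _
  ⊕-commutativeMonoid = record
    { Carrier = Pol ; _≈_ = _≋_ ; _∙_ = _⊕_ ; ε = []
    ; isCommutativeMonoid = record
      { isMonoid = record
        { isSemigroup = record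
          { isMagma = record { isEquivalence = ≋-isEquivalence ; ∙-cong = ⊕-cong }
          ; assoc = ⊕-assoc }
        ; identity = (λ _ → ≋-refl) , ⊕-identityʳ }
      ; comm = ⊕-comm }
    }

  open CommutativeSemigroupProperties (CommutativeMonoid.commutativeSemigroup ⊕-commutativeMonoid) public
    using () renaming (interchange to ⊕-interchange; x∙yz≈y∙xz to ⊕-lcomm)

  ⊕-[]ˡ : ∀ {p q} → p ≋ [] → p ⊕ q ≋ q
  ⊕-[]ˡ p≋[] = ⊕-cong p≋[] ≋-refl

  ⊕-[]ʳ : ∀ {p q} → q ≋ [] → p ⊕ q ≋ p
  ⊕-[]ʳ {p} q≋[] = ≋-trans (⊕-cong ≋-refl q≋[]) (⊕-identityʳ p)

  0∷-⊕ : ∀ p q → 0# ∷ (p ⊕ q) ≋ (0# ∷ p) ⊕ (0# ∷ q)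
  0∷-⊕ p q = ∷-cong (sym (+-identityʳ 0#)) ≋-refl

  ·-coeffwise : ∀ c p q → (∀ k → c *ᶠ coeff p k ≡ coeff q k) → c · p ≋ q
  ·-coeffwise c p q eq = ≈ₚ⇒≋ λ k → trans (coeff-· c p k) (eq k)

  ·-congʳ : ∀ {c p q} → p ≋ q → c · p ≋ c · q
  ·-congʳ {c} {p} {q} p≋q = ·-coeffwise c p (c · q) λ k →
    trans (cong (c *ᶠ_) (≋⇒≈ₚ p≋q k)) (sym (coeff-· c q k))

  ·-distribˡ-⊕ : ∀ c p q → c · (p ⊕ q) ≋ c · p ⊕ c · q
  ·-distribˡ-⊕ c p q = ·-coeffwise c (p ⊕ q) _ λ k →
    trans (cong (c *ᶠ_) (coeff-⊕ p q k))
          (trans (distribˡ c _ _)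
                 (sym (trans (coeff-⊕ (c · p) (c · q) k) (cong₂ _+ᶠ_ (coeff-· c p k) (coeff-· c q k)))))

  ·-distribʳ-+ : ∀ c d p → (c +ᶠ d) · p ≋ c · p ⊕ d · p
  ·-distribʳ-+ c d p = ·-coeffwise (c +ᶠ d) p _ λ k →
    trans (distribʳ _ c d) (sym (trans (coeff-⊕ (c · p) (d · p) k) (cong₂ _+ᶠ_ (coeff-· c p k) (coeff-· d p k))))

  ·-assoc : ∀ c d p → (c *ᶠ d) · p ≋ c · (d · p)
  ·-assoc c d p = ·-coeffwise (c *ᶠ d) p _ λ k →
    trans (*-assoc c d _) (sym (trans (coeff-· c (d · p) k) (cong (c *ᶠ_) (coeff-· d p k))))

  ·-identityˡ : ∀ p → 1# · p ≋ p
  ·-identityˡ p = ·-coeffwise 1# p p λ k → *-identityˡ _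

  ·-zeroˡ : ∀ p → 0# · p ≋ []
  ·-zeroˡ p = ·-coeffwise 0# p [] λ k → zeroˡ _

  ·-0∷ : ∀ c p → c · (0# ∷ p) ≋ 0# ∷ (c · p)
  ·-0∷ c p = ∷-cong (zeroʳ c) ≋-refl

  ·-lcomm : ∀ c d p → c · (d · p) ≋ d · (c · p)
  ·-lcomm c d p = ≋-trans (≋-sym (·-assoc c d p)) (≋-trans (≡⇒≋ (cong (_· p) (*-comm c d))) (·-assoc d c p))

  one : Pol
  one = 1# ∷ []

  ⊗-congʳ : ∀ p {q q′} → q ≋ q′ → p ⊗ q ≋ p ⊗ q′
  ⊗-congʳ []      q≋q′ = ≋-refl
  ⊗-congʳ (a ∷ p) q≋q′ = ⊕-cong (·-congʳ q≋q′) (∷-cong refl (⊗-congʳ p q≋q′))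

  ⊗-zeroʳ : ∀ p → p ⊗ [] ≋ []
  ⊗-zeroʳ []      = ≋-refl
  ⊗-zeroʳ (a ∷ p) = ≋-trans (∷-cong refl (⊗-zeroʳ p)) 0∷[]≋[]

  ⊗-distribˡ-⊕ : ∀ p q r → p ⊗ (q ⊕ r) ≋ p ⊗ q ⊕ p ⊗ r
  ⊗-distribˡ-⊕ []      q r = ≋-refl
  ⊗-distribˡ-⊕ (a ∷ p) q r = begin
    a · (q ⊕ r) ⊕ (0# ∷ p ⊗ (q ⊕ r))
      ≈⟨ ⊕-cong (·-distribˡ-⊕ a q r) (≋-trans (∷-cong refl (⊗-distribˡ-⊕ p q r)) (0∷-⊕ (p ⊗ q) (p ⊗ r))) ⟩
    (a · q ⊕ a · r) ⊕ ((0# ∷ p ⊗ q) ⊕ (0# ∷ p ⊗ r))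
      ≈⟨ ⊕-interchange (a · q) (a · r) _ _ ⟩
    (a · q ⊕ (0# ∷ p ⊗ q)) ⊕ (a · r ⊕ (0# ∷ p ⊗ r))
      ∎

  ⊗-·ʳ : ∀ c p q → p ⊗ (c · q) ≋ c · (p ⊗ q)
  ⊗-·ʳ c []      q = ≋-refl
  ⊗-·ʳ c (a ∷ p) q = begin
    a · (c · q) ⊕ (0# ∷ p ⊗ (c · q))  ≈⟨ ⊕-cong (·-lcomm a c q) (∷-cong refl (⊗-·ʳ c p q)) ⟩
    c · (a · q) ⊕ (0# ∷ c · (p ⊗ q))  ≈⟨ ⊕-cong ≋-refl (·-0∷ c (p ⊗ q)) ⟨
    c · (a · q) ⊕ c · (0# ∷ p ⊗ q)    ≈⟨ ·-distribˡ-⊕ c (a · q) (0# ∷ p ⊗ q) ⟨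
    c · (a · q ⊕ (0# ∷ p ⊗ q))        ∎

  ⊗-0∷ʳ : ∀ p q → p ⊗ (0# ∷ q) ≋ 0# ∷ p ⊗ q
  ⊗-0∷ʳ []      q = ≋-sym 0∷[]≋[]
  ⊗-0∷ʳ (a ∷ p) q = ∷-cong (trans (+-identityʳ _) (zeroʳ a)) (⊕-cong ≋-refl (⊗-0∷ʳ p q))

  ⊗-identityʳ : ∀ p → p ⊗ one ≋ p
  ⊗-identityʳ []      = ≋-refl
  ⊗-identityʳ (a ∷ p) = ∷-cong (trans (+-identityʳ _) (*-identityʳ a)) (⊗-identityʳ p)

  ⊗-comm : ∀ p q → p ⊗ q ≋ q ⊗ p
  ⊗-comm []      q = ≋-sym (⊗-zeroʳ q)
  ⊗-comm (a ∷ p) q = begin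
    a · q ⊕ (0# ∷ p ⊗ q)          ≈⟨ ⊕-cong (≋-sym q⊗a≋a·q) (∷-cong refl (⊗-comm p q)) ⟩
    q ⊗ (a ∷ []) ⊕ (0# ∷ q ⊗ p)   ≈⟨ ⊕-cong ≋-refl (⊗-0∷ʳ q p) ⟨
    q ⊗ (a ∷ []) ⊕ q ⊗ (0# ∷ p)   ≈⟨ ⊗-distribˡ-⊕ q _ _ ⟨
    q ⊗ ((a ∷ []) ⊕ (0# ∷ p))     ≈⟨ ⊗-congʳ q (∷-cong (+-identityʳ a) ≋-refl) ⟩
    q ⊗ (a ∷ p)                   ∎
    where
    q⊗a≋a·q : q ⊗ (a ∷ []) ≋ a · q
    q⊗a≋a·q = begin
      q ⊗ (a ∷ [])   ≈⟨ ⊗-congʳ q (∷-cong (sym (*-identityʳ a)) ≋-refl) ⟩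
      q ⊗ (a · one)  ≈⟨ ⊗-·ʳ a q one ⟩
      a · (q ⊗ one)  ≈⟨ ·-congʳ (⊗-identityʳ q) ⟩
      a · q          ∎

  ⊗-congˡ : ∀ {p p′} q → p ≋ p′ → p ⊗ q ≋ p′ ⊗ q
  ⊗-congˡ {p} {p′} q p≋p′ = ≋-trans (⊗-comm p q) (≋-trans (⊗-congʳ q p≋p′) (⊗-comm q p′))

  ⊗-cong : ∀ {p p′ q q′} → p ≋ p′ → q ≋ q′ → p ⊗ q ≋ p′ ⊗ q′
  ⊗-cong {p′ = p′} {q} p≋p′ q≋q′ = ≋-trans (⊗-congˡ q p≋p′) (⊗-congʳ p′ q≋q′)

  ⊗-≋[]ˡ : ∀ {p} q → p ≋ [] → p ⊗ q ≋ []
  ⊗-≋[]ˡ q p≋[] = ⊗-congˡ q p≋[]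

  ⊗-≋[]ʳ : ∀ p {q} → q ≋ [] → p ⊗ q ≋ []
  ⊗-≋[]ʳ p q≋[] = ≋-trans (⊗-congʳ p q≋[]) (⊗-zeroʳ p)

  ⊗-distribʳ-⊕ : ∀ p q r → (p ⊕ q) ⊗ r ≋ p ⊗ r ⊕ q ⊗ r
  ⊗-distribʳ-⊕ p q r = begin
    (p ⊕ q) ⊗ r      ≈⟨ ⊗-comm (p ⊕ q) r ⟩
    r ⊗ (p ⊕ q)      ≈⟨ ⊗-distribˡ-⊕ r p q ⟩
    r ⊗ p ⊕ r ⊗ q    ≈⟨ ⊕-cong (⊗-comm r p) (⊗-comm r q) ⟩
    p ⊗ r ⊕ q ⊗ r    ∎

  ⊗-·ˡ : ∀ c p q → (c · p) ⊗ q ≋ c · (p ⊗ q)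
  ⊗-·ˡ c p q = ≋-trans (⊗-comm (c · p) q) (≋-trans (⊗-·ʳ c q p) (·-congʳ (⊗-comm q p)))

  ⊗-0∷ˡ : ∀ p q → (0# ∷ p) ⊗ q ≋ 0# ∷ p ⊗ q
  ⊗-0∷ˡ p q = ⊕-[]ˡ (·-zeroˡ q)

  ⊗-identityˡ : ∀ p → one ⊗ p ≋ p
  ⊗-identityˡ p = ≋-trans (⊗-comm one p) (⊗-identityʳ p)

  ⊗-assoc : ∀ p q r → (p ⊗ q) ⊗ r ≋ p ⊗ (q ⊗ r)
  ⊗-assoc []      q r = ≋-refl
  ⊗-assoc (a ∷ p) q r = begin
    (a · q ⊕ (0# ∷ p ⊗ q)) ⊗ r        ≈⟨ ⊗-distribʳ-⊕ (a · q) _ r ⟩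
    (a · q) ⊗ r ⊕ (0# ∷ p ⊗ q) ⊗ r    ≈⟨ ⊕-cong (⊗-·ˡ a q r) (⊗-0∷ˡ (p ⊗ q) r) ⟩
    a · (q ⊗ r) ⊕ (0# ∷ (p ⊗ q) ⊗ r)  ≈⟨ ⊕-cong ≋-refl (∷-cong refl (⊗-assoc p q r)) ⟩
    a · (q ⊗ r) ⊕ (0# ∷ p ⊗ (q ⊗ r))  ∎

  ⊗-lcomm : ∀ p q r → p ⊗ (q ⊗ r) ≋ q ⊗ (p ⊗ r)
  ⊗-lcomm p q r = ≋-trans (≋-sym (⊗-assoc p q r)) (≋-trans (⊗-congˡ r (⊗-comm p q)) (⊗-assoc q p r))

  ^ₚ-cong : ∀ {p q} k → p ≋ q → p ^ₚ k ≋ q ^ₚ k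
  ^ₚ-cong zero    p≋q = ≋-refl
  ^ₚ-cong (suc k) p≋q = ⊗-cong p≋q (^ₚ-cong k p≋q)

  ^ₚ-homo-⊗ : ∀ p i j → p ^ₚ (i + j) ≋ p ^ₚ i ⊗ p ^ₚ j
  ^ₚ-homo-⊗ p zero    j = ≋-sym (⊗-identityˡ (p ^ₚ j))
  ^ₚ-homo-⊗ p (suc i) j = ≋-trans (⊗-congʳ p (^ₚ-homo-⊗ p i j)) (≋-sym (⊗-assoc p (p ^ₚ i) (p ^ₚ j)))

  ^ₚ-distrib-· : ∀ c p k → (c · p) ^ₚ k ≋ (c ^ᶠ k) · p ^ₚ k
  ^ₚ-distrib-· c p zero    = ≋-sym (·-identityˡ one)
  ^ₚ-distrib-· c p (suc k) = begin
    (c · p) ⊗ (c · p) ^ₚ k         ≈⟨ ⊗-congʳ (c · p) (^ₚ-distrib-· c p k) ⟩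
    (c · p) ⊗ (c ^ᶠ k · p ^ₚ k)    ≈⟨ ⊗-·ˡ c p _ ⟩
    c · (p ⊗ (c ^ᶠ k · p ^ₚ k))    ≈⟨ ·-congʳ (⊗-·ʳ (c ^ᶠ k) p (p ^ₚ k)) ⟩
    c · (c ^ᶠ k · (p ⊗ p ^ₚ k))    ≈⟨ ·-assoc c (c ^ᶠ k) _ ⟨
    c ^ᶠ suc k · (p ⊗ p ^ₚ k)      ∎

  one-^ₚ : ∀ k → one ^ₚ k ≋ one
  one-^ₚ zero    = ≋-refl
  one-^ₚ (suc k) = ≋-trans (⊗-identityˡ _) (one-^ₚ k)

  Deg≤-mono : ∀ {p i j} → i ≤ j → Deg≤ p i → Deg≤ p j
  Deg≤-mono i≤j p≤i = DegLe⇒Deg≤ λ k j<k → Deg≤⇒DegLe p≤i k (ℕ.≤-<-trans i≤j j<k)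

  ≋[]⇒Deg≤ : ∀ {p m} → p ≋ [] → Deg≤ p m
  ≋[]⇒Deg≤ p≋[] = DegLe⇒Deg≤ λ k _ → ≋⇒≈ₚ p≋[] k

  Deg≤-⊕ : ∀ {p q m} → Deg≤ p m → Deg≤ q m → Deg≤ (p ⊕ q) m
  Deg≤-⊕ {p} {q} p≤m q≤m = DegLe⇒Deg≤ λ k m<k →
    trans (coeff-⊕ p q k) (trans (cong₂ _+ᶠ_ (Deg≤⇒DegLe p≤m k m<k) (Deg≤⇒DegLe q≤m k m<k)) (+-identityʳ 0#))

  Deg≤-· : ∀ {c p m} → Deg≤ p m → Deg≤ (c · p) m
  Deg≤-· {c} {p} p≤m = DegLe⇒Deg≤ λ k m<k →
    trans (coeff-· c p k) (trans (cong (c *ᶠ_) (Deg≤⇒DegLe p≤m k m<k)) (zeroʳ c))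

  Deg≤-∷ : ∀ {a p m} → Deg≤ p m → Deg≤ (a ∷ p) (suc m)
  Deg≤-∷ p≤m = DegLe⇒Deg≤ λ { zero () ; (suc k) (s≤s m<k) → Deg≤⇒DegLe p≤m k m<k }

  Deg≤-tail : ∀ {a p m} → Deg≤ (a ∷ p) (suc m) → Deg≤ p m
  Deg≤-tail a∷p≤1+m = DegLe⇒Deg≤ λ k m<k → Deg≤⇒DegLe a∷p≤1+m (suc k) (s≤s m<k)

  Deg≤0⇒tail≋[] : ∀ {a p} → Deg≤ (a ∷ p) 0 → p ≋ []
  Deg≤0⇒tail≋[] a∷p≤0 = ≈ₚ⇒≋ λ k → Deg≤⇒DegLe a∷p≤0 (suc k) (s≤s z≤n)

  Deg≤-⊗ : ∀ {p q i j} → Deg≤ p i → Deg≤ q j → Deg≤ (p ⊗ q) (i + j)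
  Deg≤-⊗ {[]} _ _ = ≋[]⇒Deg≤ ≋-refl
  Deg≤-⊗ {a ∷ p} {q} {zero} p≤0 q≤j =
    Deg≤-⊕ (Deg≤-· q≤j) (≋[]⇒Deg≤ (≋-trans (∷-cong refl (⊗-≋[]ˡ q (Deg≤0⇒tail≋[] p≤0))) 0∷[]≋[]))
  Deg≤-⊗ {a ∷ p} {q} {suc i} {j} p≤1+i q≤j =
    Deg≤-⊕ (Deg≤-mono (ℕ.m≤n+m j (suc i)) (Deg≤-· q≤j)) (Deg≤-∷ (Deg≤-⊗ (Deg≤-tail p≤1+i) q≤j))

  Deg≤-constant : ∀ a → Deg≤ (a ∷ []) 0
  Deg≤-constant a = DegLe⇒Deg≤ λ { zero () ; (suc k) _ → refl }

  Deg≤-^ₚ : ∀ {p} k → Deg≤ p 1 → Deg≤ (p ^ₚ k) k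
  Deg≤-^ₚ zero    p≤1 = Deg≤-constant 1#
  Deg≤-^ₚ (suc k) p≤1 = Deg≤-⊗ p≤1 (Deg≤-^ₚ k p≤1)

  linear : Carrier → Carrier → Pol
  linear β α = β ∷ α ∷ []

  X : Pol
  X = linear 0# 1#

  Deg≤-linear : ∀ β α → Deg≤ (linear β α) 1
  Deg≤-linear β α = Deg≤-∷ (Deg≤-constant α)

  ∑≤ : ℕ → (ℕ → Pol) → Pol
  ∑≤ zero    T = T zero
  ∑≤ (suc k) T = T (suc k) ⊕ ∑≤ k T

  ∑≤-suc : ∀ k T → ∑≤ (suc k) T ≋ T 0 ⊕ ∑≤ k (T ∘ suc)
  ∑≤-suc zero    T = ⊕-comm (T 1) (T 0)
  ∑≤-suc (suc k) T = ≋-trans (⊕-cong (≋-refl {T (suc (suc k))}) (∑≤-suc k T)) (⊕-lcomm (T (suc (suc k))) (T 0) _)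

  ∑≤-cong : ∀ k {T U} → (∀ j → T j ≋ U j) → ∑≤ k T ≋ ∑≤ k U
  ∑≤-cong zero    T≋U = T≋U zero
  ∑≤-cong (suc k) T≋U = ⊕-cong (T≋U (suc k)) (∑≤-cong k T≋U)

  ⊗-∑≤ : ∀ k p T → p ⊗ ∑≤ k T ≋ ∑≤ k (λ j → p ⊗ T j)
  ⊗-∑≤ zero    p T = ≋-refl
  ⊗-∑≤ (suc k) p T = ≋-trans (⊗-distribˡ-⊕ p (T (suc k)) (∑≤ k T)) (⊕-cong ≋-refl (⊗-∑≤ k p T))

  ∑≤-≋[] : ∀ k {T} → (∀ j → T j ≋ []) → ∑≤ k T ≋ []
  ∑≤-≋[] zero    T≋[] = T≋[] zero
  ∑≤-≋[] (suc k) T≋[] = ≋-trans (⊕-[]ˡ (T≋[] (suc k))) (∑≤-≋[] k T≋[])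

ψ-term : ∀ {n} (F : GF2^ n) → ℕ → Poly.GL2 F → Poly.Pol F → ℕ → Poly.Pol F
ψ-term F m A f k = coeff f k · ((b ∷ a ∷ []) ^ₚ k ⊗ (d ∷ c ∷ []) ^ₚ (m ∸ k))
  where
  open Poly F
  open GL2 A

-- ψ sums its terms with a where-bound loop, which cannot be named directly.
-- Generalising suc m in ψ-loop-suc makes its equation a pattern for the meta ψ-loop,
-- which unification then solves with that loop.
mutual
  ψ-loop : ∀ {n} (F : GF2^ n) → ℕ → Poly.GL2 F → Poly.Pol F → ℕ → Poly.Pol F
  ψ-loop = _

  ψ-loop-suc : ∀ {n} (F : GF2^ n) m A f →
               Poly.ψ F (suc m) A f ≡ Poly._⊕_ F (ψ-term F (suc m) A f (suc m)) (ψ-loop F (suc m) A f m)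
  ψ-loop-suc F m A f with suc m
  ... | _ = refl

module PolynomialSubstitution {n : ℕ} (F : GF2^ n) where
  open Poly F
  open FiniteField F
  open Polynomial F
  open SetoidReasoning ≋-setoid

  -- Ψ m L M f = M ^ m · f (L / M) by Horner's rule.  For deg f > m the tail is
  -- evaluated at degree pred 0 = 0, so only the case deg f ≤ m is meaningful.
  Ψ : ℕ → Pol → Pol → Pol → Pol
  Ψ m L M []      = []
  Ψ m L M (a ∷ f) = a · M ^ₚ m ⊕ L ⊗ Ψ (pred m) L M f

  Ψ-≋[] : ∀ m L M {f} → f ≋ [] → Ψ m L M f ≋ []
  Ψ-≋[] m L M {[]}    f≋[] = ≋-refl
  Ψ-≋[] m L M {a ∷ f} f≋[] =
    ≋-trans (⊕-[]ˡ (≋-trans (≡⇒≋ (cong (_· M ^ₚ m) (∷≋[]⇒head≡0 f≋[]))) (·-zeroˡ _)))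
            (⊗-≋[]ʳ L (Ψ-≋[] (pred m) L M (∷≋[]⇒tail≋[] f≋[])))

  Ψ₀-tail≋[] : ∀ L M {a f} → Deg≤ (a ∷ f) 0 → L ⊗ Ψ 0 L M f ≋ []
  Ψ₀-tail≋[] L M a∷f≤0 = ⊗-≋[]ʳ L (Ψ-≋[] 0 L M (Deg≤0⇒tail≋[] a∷f≤0))

  Ψ-cong : ∀ m {L L′ M M′} f → L ≋ L′ → M ≋ M′ → Ψ m L M f ≋ Ψ m L′ M′ f
  Ψ-cong m []      L≋L′ M≋M′ = ≋-refl
  Ψ-cong m (a ∷ f) L≋L′ M≋M′ = ⊕-cong (·-congʳ (^ₚ-cong m M≋M′)) (⊗-cong L≋L′ (Ψ-cong (pred m) f L≋L′ M≋M′))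

  Ψ-⊕ : ∀ m L M f g → Ψ m L M (f ⊕ g) ≋ Ψ m L M f ⊕ Ψ m L M g
  Ψ-⊕ m L M []      g       = ≋-refl
  Ψ-⊕ m L M (a ∷ f) []      = ≋-sym (⊕-identityʳ _)
  Ψ-⊕ m L M (a ∷ f) (b ∷ g) = begin
    (a +ᶠ b) · M ^ₚ m ⊕ L ⊗ Ψ (pred m) L M (f ⊕ g)
      ≈⟨ ⊕-cong (·-distribʳ-+ a b (M ^ₚ m)) (≋-trans (⊗-congʳ L (Ψ-⊕ (pred m) L M f g)) (⊗-distribˡ-⊕ L _ _)) ⟩
    (a · M ^ₚ m ⊕ b · M ^ₚ m) ⊕ (L ⊗ Ψ (pred m) L M f ⊕ L ⊗ Ψ (pred m) L M g)
      ≈⟨ ⊕-interchange (a · M ^ₚ m) _ _ _ ⟩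
    (a · M ^ₚ m ⊕ L ⊗ Ψ (pred m) L M f) ⊕ (b · M ^ₚ m ⊕ L ⊗ Ψ (pred m) L M g)
      ∎

  Ψ-· : ∀ m L M c f → Ψ m L M (c · f) ≋ c · Ψ m L M f
  Ψ-· m L M c []      = ≋-refl
  Ψ-· m L M c (a ∷ f) = begin
    (c *ᶠ a) · M ^ₚ m ⊕ L ⊗ Ψ (pred m) L M (c · f)
      ≈⟨ ⊕-cong (·-assoc c a (M ^ₚ m)) (≋-trans (⊗-congʳ L (Ψ-· (pred m) L M c f)) (⊗-·ʳ c L _)) ⟩
    c · (a · M ^ₚ m) ⊕ c · (L ⊗ Ψ (pred m) L M f)
      ≈⟨ ·-distribˡ-⊕ c (a · M ^ₚ m) _ ⟨
    c · (a · M ^ₚ m ⊕ L ⊗ Ψ (pred m) L M f)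
      ∎

  Ψ-raise : ∀ L M i j g → Deg≤ g j → Ψ (i + j) L M g ≋ M ^ₚ i ⊗ Ψ j L M g
  Ψ-raise L M i j       []      _     = ≋-sym (⊗-zeroʳ (M ^ₚ i))
  Ψ-raise L M i zero    (b ∷ g) b∷g≤0 = begin
    b · M ^ₚ (i + 0) ⊕ L ⊗ Ψ (pred (i + 0)) L M g
      ≈⟨ ⊕-[]ʳ (⊗-≋[]ʳ L (Ψ-≋[] _ L M (Deg≤0⇒tail≋[] b∷g≤0))) ⟩
    b · M ^ₚ (i + 0)
      ≈⟨ ·-congʳ (^ₚ-homo-⊗ M i 0) ⟩
    b · (M ^ₚ i ⊗ one)
      ≈⟨ ⊗-·ʳ b (M ^ₚ i) one ⟨
    M ^ₚ i ⊗ (b · one)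
      ≈⟨ ⊗-congʳ (M ^ₚ i) (⊕-[]ʳ (Ψ₀-tail≋[] L M b∷g≤0)) ⟨
    M ^ₚ i ⊗ (b · one ⊕ L ⊗ Ψ 0 L M g)
      ∎
  Ψ-raise L M i (suc j) (b ∷ g) b∷g≤1+j = begin
    Ψ (i + suc j) L M (b ∷ g)
      ≈⟨ ≡⇒≋ (cong (λ k → Ψ k L M (b ∷ g)) (ℕ.+-suc i j)) ⟩
    b · M ^ₚ suc (i + j) ⊕ L ⊗ Ψ (i + j) L M g
      ≈⟨ ⊕-cong (·-congʳ M^[1+i+j]≋M^i⊗M^[1+j]) (⊗-congʳ L (Ψ-raise L M i j g (Deg≤-tail b∷g≤1+j))) ⟩
    b · (M ^ₚ i ⊗ M ^ₚ suc j) ⊕ L ⊗ (M ^ₚ i ⊗ Ψ j L M g)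
      ≈⟨ ⊕-cong (≋-sym (⊗-·ʳ b (M ^ₚ i) (M ^ₚ suc j))) (⊗-lcomm L (M ^ₚ i) (Ψ j L M g)) ⟩
    M ^ₚ i ⊗ (b · M ^ₚ suc j) ⊕ M ^ₚ i ⊗ (L ⊗ Ψ j L M g)
      ≈⟨ ⊗-distribˡ-⊕ (M ^ₚ i) _ _ ⟨
    M ^ₚ i ⊗ (b · M ^ₚ suc j ⊕ L ⊗ Ψ j L M g)
      ∎
    where
    M^[1+i+j]≋M^i⊗M^[1+j] : M ^ₚ suc (i + j) ≋ M ^ₚ i ⊗ M ^ₚ suc j
    M^[1+i+j]≋M^i⊗M^[1+j] = ≋-trans (≡⇒≋ (cong (M ^ₚ_) (sym (ℕ.+-suc i j)))) (^ₚ-homo-⊗ M i (suc j))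

  Ψ-⊗ : ∀ L M i j f g → Deg≤ f i → Deg≤ g j → Ψ (i + j) L M (f ⊗ g) ≋ Ψ i L M f ⊗ Ψ j L M g
  Ψ-⊗ L M i       j []      g _   _   = ≋-refl
  Ψ-⊗ L M zero    j (a ∷ f) g a∷f≤0 g≤j = begin
    Ψ j L M (a · g ⊕ (0# ∷ f ⊗ g))
      ≈⟨ Ψ-⊕ j L M (a · g) _ ⟩
    Ψ j L M (a · g) ⊕ Ψ j L M (0# ∷ f ⊗ g)
      ≈⟨ ⊕-[]ʳ (Ψ-≋[] j L M (≋-trans (∷-cong refl (⊗-≋[]ˡ g (Deg≤0⇒tail≋[] a∷f≤0))) 0∷[]≋[])) ⟩
    Ψ j L M (a · g)
      ≈⟨ Ψ-· j L M a g ⟩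
    a · Ψ j L M g
      ≈⟨ ·-congʳ (⊗-identityˡ _) ⟨
    a · (one ⊗ Ψ j L M g)
      ≈⟨ ⊗-·ˡ a one _ ⟨
    (a · one) ⊗ Ψ j L M g
      ≈⟨ ⊗-congˡ (Ψ j L M g) (⊕-[]ʳ (Ψ₀-tail≋[] L M a∷f≤0)) ⟨
    (a · one ⊕ L ⊗ Ψ 0 L M f) ⊗ Ψ j L M g
      ∎
  Ψ-⊗ L M (suc i) j (a ∷ f) g a∷f≤1+i g≤j = begin
    Ψ (suc i + j) L M (a · g ⊕ (0# ∷ f ⊗ g))
      ≈⟨ Ψ-⊕ (suc i + j) L M (a · g) _ ⟩
    Ψ (suc i + j) L M (a · g) ⊕ Ψ (suc i + j) L M (0# ∷ f ⊗ g)
      ≈⟨ ⊕-cong (Ψ-· (suc i + j) L M a g) (⊕-[]ˡ (·-zeroˡ _)) ⟩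
    a · Ψ (suc i + j) L M g ⊕ L ⊗ Ψ (i + j) L M (f ⊗ g)
      ≈⟨ ⊕-cong (·-congʳ (Ψ-raise L M (suc i) j g g≤j)) (⊗-congʳ L (Ψ-⊗ L M i j f g (Deg≤-tail a∷f≤1+i) g≤j)) ⟩
    a · (M ^ₚ suc i ⊗ Ψ j L M g) ⊕ L ⊗ (Ψ i L M f ⊗ Ψ j L M g)
      ≈⟨ ⊕-cong (⊗-·ˡ a (M ^ₚ suc i) _) (⊗-assoc L _ _) ⟨
    (a · M ^ₚ suc i) ⊗ Ψ j L M g ⊕ (L ⊗ Ψ i L M f) ⊗ Ψ j L M g
      ≈⟨ ⊗-distribʳ-⊕ (a · M ^ₚ suc i) _ _ ⟨
    (a · M ^ₚ suc i ⊕ L ⊗ Ψ i L M f) ⊗ Ψ j L M g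
      ∎

  Deg≤-Ψ : ∀ {L M} m f → Deg≤ L 1 → Deg≤ M 1 → Deg≤ f m → Deg≤ (Ψ m L M f) m
  Deg≤-Ψ m       []      L≤1 M≤1 _       = ≋[]⇒Deg≤ ≋-refl
  Deg≤-Ψ {L} {M} zero (a ∷ f) L≤1 M≤1 a∷f≤0 =
    Deg≤-⊕ (Deg≤-· (Deg≤-^ₚ 0 M≤1)) (≋[]⇒Deg≤ (Ψ₀-tail≋[] L M a∷f≤0))
  Deg≤-Ψ (suc m) (a ∷ f) L≤1 M≤1 a∷f≤1+m =
    Deg≤-⊕ (Deg≤-· (Deg≤-^ₚ (suc m) M≤1)) (Deg≤-⊗ L≤1 (Deg≤-Ψ m f L≤1 M≤1 (Deg≤-tail a∷f≤1+m)))

  Ψ-^ₚ : ∀ {L M P} → Deg≤ P 1 → ∀ k → Ψ k L M (P ^ₚ k) ≋ Ψ 1 L M P ^ₚ k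
  Ψ-^ₚ {L}         P≤1 zero    = ≋-trans (⊕-[]ʳ (⊗-zeroʳ L)) (·-identityˡ one)
  Ψ-^ₚ {L} {M} {P} P≤1 (suc k) =
    ≋-trans (Ψ-⊗ L M 1 k P (P ^ₚ k) P≤1 (Deg≤-^ₚ k P≤1)) (⊗-congʳ (Ψ 1 L M P) (Ψ-^ₚ P≤1 k))

  Ψ-∘ : ∀ {L M L′ M′} → Deg≤ L′ 1 → Deg≤ M′ 1 → ∀ m f → Deg≤ f m →
        Ψ m L M (Ψ m L′ M′ f) ≋ Ψ m (Ψ 1 L M L′) (Ψ 1 L M M′) f
  Ψ-∘ L′≤1 M′≤1 m [] _ = ≋-refl
  Ψ-∘ {L} {M} {L′} {M′} L′≤1 M′≤1 m (a ∷ f) a∷f≤m = begin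
    Ψ m L M (a · M′ ^ₚ m ⊕ L′ ⊗ Ψ (pred m) L′ M′ f)
      ≈⟨ Ψ-⊕ m L M (a · M′ ^ₚ m) _ ⟩
    Ψ m L M (a · M′ ^ₚ m) ⊕ Ψ m L M (L′ ⊗ Ψ (pred m) L′ M′ f)
      ≈⟨ ⊕-cong (≋-trans (Ψ-· m L M a (M′ ^ₚ m)) (·-congʳ (Ψ-^ₚ M′≤1 m))) (Ψ-∘-tail m a∷f≤m) ⟩
    a · Ψ 1 L M M′ ^ₚ m ⊕ Ψ 1 L M L′ ⊗ Ψ (pred m) (Ψ 1 L M L′) (Ψ 1 L M M′) f
      ∎
    where
    Ψ-∘-tail : ∀ m → Deg≤ (a ∷ f) m →
               Ψ m L M (L′ ⊗ Ψ (pred m) L′ M′ f) ≋ Ψ 1 L M L′ ⊗ Ψ (pred m) (Ψ 1 L M L′) (Ψ 1 L M M′) f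
    Ψ-∘-tail zero    a∷f≤0   =
      ≋-trans (Ψ-≋[] 0 L M (Ψ₀-tail≋[] L′ M′ a∷f≤0)) (≋-sym (Ψ₀-tail≋[] (Ψ 1 L M L′) (Ψ 1 L M M′) a∷f≤0))
    Ψ-∘-tail (suc m) a∷f≤1+m =
      ≋-trans (Ψ-⊗ L M 1 m L′ _ L′≤1 (Deg≤-Ψ m f L′≤1 M′≤1 f≤m)) (⊗-congʳ (Ψ 1 L M L′) (Ψ-∘ L′≤1 M′≤1 m f f≤m))
      where
      f≤m = Deg≤-tail a∷f≤1+m

  Ψ-identity : ∀ m f → Deg≤ f m → Ψ m X one f ≋ f
  Ψ-identity m []      _     = ≋-refl
  Ψ-identity m (a ∷ f) a∷f≤m = begin
    a · one ^ₚ m ⊕ X ⊗ Ψ (pred m) X one f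
      ≈⟨ ⊕-cong (·-congʳ (one-^ₚ m)) (≋-trans (X⊗ _) (∷-cong refl (Ψ-identity-tail m a∷f≤m))) ⟩
    a · one ⊕ (0# ∷ f)
      ≈⟨ ∷-cong (trans (+-identityʳ _) (*-identityʳ a)) ≋-refl ⟩
    a ∷ f
      ∎
    where
    X⊗ : ∀ p → X ⊗ p ≋ 0# ∷ p
    X⊗ p = ≋-trans (⊕-[]ˡ (·-zeroˡ p)) (∷-cong refl (⊗-identityˡ p))
    Ψ-identity-tail : ∀ m → Deg≤ (a ∷ f) m → Ψ (pred m) X one f ≋ f
    Ψ-identity-tail zero    a∷f≤0   = ≋-trans (Ψ-≋[] 0 X one f≋[]) (≋-sym f≋[])
      where
      f≋[] = Deg≤0⇒tail≋[] a∷f≤0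
    Ψ-identity-tail (suc m) a∷f≤1+m = Ψ-identity m f (Deg≤-tail a∷f≤1+m)

  Ψ-scale : ∀ c L M m f → Deg≤ f m → Ψ m (c · L) (c · M) f ≋ c ^ᶠ m · Ψ m L M f
  Ψ-scale c L M m []      _     = ≋-refl
  Ψ-scale c L M m (a ∷ f) a∷f≤m = begin
    a · (c · M) ^ₚ m ⊕ (c · L) ⊗ Ψ (pred m) (c · L) (c · M) f
      ≈⟨ ⊕-cong (≋-trans (·-congʳ (^ₚ-distrib-· c M m)) (·-lcomm a (c ^ᶠ m) _)) (Ψ-scale-tail m a∷f≤m) ⟩
    c ^ᶠ m · (a · M ^ₚ m) ⊕ c ^ᶠ m · (L ⊗ Ψ (pred m) L M f)
      ≈⟨ ·-distribˡ-⊕ (c ^ᶠ m) (a · M ^ₚ m) (L ⊗ Ψ (pred m) L M f) ⟨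
    c ^ᶠ m · (a · M ^ₚ m ⊕ L ⊗ Ψ (pred m) L M f)
      ∎
    where
    Ψ-scale-tail : ∀ m → Deg≤ (a ∷ f) m →
                   (c · L) ⊗ Ψ (pred m) (c · L) (c · M) f ≋ c ^ᶠ m · (L ⊗ Ψ (pred m) L M f)
    Ψ-scale-tail zero    a∷f≤0   =
      ≋-trans (Ψ₀-tail≋[] (c · L) (c · M) a∷f≤0) (≋-sym (·-congʳ (Ψ₀-tail≋[] L M a∷f≤0)))
    Ψ-scale-tail (suc m) a∷f≤1+m = begin
      (c · L) ⊗ Ψ m (c · L) (c · M) f  ≈⟨ ⊗-congʳ (c · L) (Ψ-scale c L M m f (Deg≤-tail a∷f≤1+m)) ⟩
      (c · L) ⊗ (c ^ᶠ m · Ψ m L M f)   ≈⟨ ⊗-·ˡ c L _ ⟩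
      c · (L ⊗ (c ^ᶠ m · Ψ m L M f))   ≈⟨ ·-congʳ (⊗-·ʳ (c ^ᶠ m) L _) ⟩
      c · (c ^ᶠ m · (L ⊗ Ψ m L M f))   ≈⟨ ·-assoc c (c ^ᶠ m) _ ⟨
      c ^ᶠ suc m · (L ⊗ Ψ m L M f)     ∎

  Ψ₁-linear : ∀ L M β α → Ψ 1 L M (linear β α) ≋ β · M ⊕ α · L
  Ψ₁-linear L M β α = ⊕-cong (·-congʳ (⊗-identityʳ M)) (begin
    L ⊗ (α · one ⊕ L ⊗ [])  ≈⟨ ⊗-congʳ L (⊕-[]ʳ (⊗-zeroʳ L)) ⟩
    L ⊗ (α · one)           ≈⟨ ⊗-·ʳ α L one ⟩
    α · (L ⊗ one)           ≈⟨ ·-congʳ (⊗-identityʳ L) ⟩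
    α · L                   ∎)

  Ψ-as-∑ : ∀ L M m f → Deg≤ f m → Ψ m L M f ≋ ∑≤ m (λ j → coeff f j · (L ^ₚ j ⊗ M ^ₚ (m ∸ j)))
  Ψ-as-∑ L M m       []      _ = ≋-sym (∑≤-≋[] m λ j → ·-zeroˡ _)
  Ψ-as-∑ L M zero    (a ∷ f) a∷f≤0 = ≋-trans (⊕-[]ʳ (Ψ₀-tail≋[] L M a∷f≤0)) (·-congʳ (≋-sym (⊗-identityˡ one)))
  Ψ-as-∑ L M (suc m) (a ∷ f) a∷f≤1+m = begin
    a · M ^ₚ suc m ⊕ L ⊗ Ψ m L M f
      ≈⟨ ⊕-cong (·-congʳ (≋-sym (⊗-identityˡ (M ^ₚ suc m)))) (⊗-congʳ L (Ψ-as-∑ L M m f (Deg≤-tail a∷f≤1+m))) ⟩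
    T 0 ⊕ L ⊗ ∑≤ m (λ j → coeff f j · (L ^ₚ j ⊗ M ^ₚ (m ∸ j)))
      ≈⟨ ⊕-cong (≋-refl {T 0}) (≋-trans (⊗-∑≤ m L _) (∑≤-cong m L⊗term≋next-term)) ⟩
    T 0 ⊕ ∑≤ m (T ∘ suc)
      ≈⟨ ∑≤-suc m T ⟨
    ∑≤ (suc m) T
      ∎
    where
    T : ℕ → Pol
    T j = coeff (a ∷ f) j · (L ^ₚ j ⊗ M ^ₚ (suc m ∸ j))
    L⊗term≋next-term : ∀ j → L ⊗ (coeff f j · (L ^ₚ j ⊗ M ^ₚ (m ∸ j))) ≋ T (suc j)
    L⊗term≋next-term j = ≋-trans (⊗-·ʳ (coeff f j) L _) (·-congʳ (≋-sym (⊗-assoc L (L ^ₚ j) _)))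

  numerator denominator : GL2 → Pol
  numerator   A = linear (GL2.b A) (GL2.a A)
  denominator A = linear (GL2.d A) (GL2.c A)

  ψ-as-∑ : ∀ m A f → ψ m A f ≡ ∑≤ m (ψ-term F m A f)
  ψ-as-∑ zero    A f = refl
  ψ-as-∑ (suc m) A f = trans (ψ-loop-suc F m A f) (cong (ψ-term F (suc m) A f (suc m) ⊕_) (loop-as-∑ m))
    where
    loop-as-∑ : ∀ k → ψ-loop F (suc m) A f k ≡ ∑≤ k (ψ-term F (suc m) A f)
    loop-as-∑ zero    = refl
    loop-as-∑ (suc k) = cong (ψ-term F (suc m) A f (suc k) ⊕_) (loop-as-∑ k)

  ψ≋Ψ : ∀ m A {f} → Deg≤ f m → ψ m A f ≋ Ψ m (numerator A) (denominator A) f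
  ψ≋Ψ m A {f} f≤m = ≋-trans (≡⇒≋ (ψ-as-∑ m A f)) (≋-sym (Ψ-as-∑ (numerator A) (denominator A) m f f≤m))

  ψ-⊕ : ∀ m A {f g} → Deg≤ f m → Deg≤ g m → ψ m A (f ⊕ g) ≋ ψ m A f ⊕ ψ m A g
  ψ-⊕ m A {f} {g} f≤m g≤m = begin
    ψ m A (f ⊕ g)            ≈⟨ ψ≋Ψ m A (Deg≤-⊕ f≤m g≤m) ⟩
    Ψ m L M (f ⊕ g)          ≈⟨ Ψ-⊕ m L M f g ⟩
    Ψ m L M f ⊕ Ψ m L M g    ≈⟨ ⊕-cong (ψ≋Ψ m A f≤m) (ψ≋Ψ m A g≤m) ⟨
    ψ m A f ⊕ ψ m A g        ∎
    where
    L = numerator A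
    M = denominator A

  ψ-⊗ : ∀ i j A {f g} → Deg≤ f i → Deg≤ g j → ψ (i + j) A (f ⊗ g) ≋ ψ i A f ⊗ ψ j A g
  ψ-⊗ i j A {f} {g} f≤i g≤j = begin
    ψ (i + j) A (f ⊗ g)      ≈⟨ ψ≋Ψ (i + j) A (Deg≤-⊗ f≤i g≤j) ⟩
    Ψ (i + j) L M (f ⊗ g)    ≈⟨ Ψ-⊗ L M i j f g f≤i g≤j ⟩
    Ψ i L M f ⊗ Ψ j L M g    ≈⟨ ⊗-cong (ψ≋Ψ i A f≤i) (ψ≋Ψ j A g≤j) ⟨
    ψ i A f ⊗ ψ j A g        ∎
    where
    L = numerator A
    M = denominator A

  det : GL2 → Carrier
  det A = a *ᶠ d - b *ᶠ c
    where open GL2 A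

  _•_ : ∀ {l} → l ≢ 0# → GL2 → GL2
  _•_ {l} l≢0 A = mat (l *ᶠ a) (l *ᶠ b) (l *ᶠ c) (l *ᶠ d) det≢0′
    where
    open GL2 A
    det≢0′ : (l *ᶠ a) *ᶠ (l *ᶠ d) - (l *ᶠ b) *ᶠ (l *ᶠ c) ≢ 0#
    det≢0′ det′≡0 =
      det≢0 (*-cancelˡ (*-≢0 l≢0 l≢0) (trans (sym (det-scale l a b c d)) (trans det′≡0 (sym (zeroʳ _)))))

  ψ-• : ∀ m A {l} (l≢0 : l ≢ 0#) {f} → Deg≤ f m → ψ m (l≢0 • A) f ≋ l ^ᶠ m · ψ m A f
  ψ-• m A {l} l≢0 {f} f≤m = begin
    ψ m (l≢0 • A) f                               ≈⟨ ψ≋Ψ m (l≢0 • A) f≤m ⟩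
    Ψ m (l · numerator A) (l · denominator A) f   ≈⟨ Ψ-scale l (numerator A) (denominator A) m f f≤m ⟩
    l ^ᶠ m · Ψ m (numerator A) (denominator A) f  ≈⟨ ·-congʳ (ψ≋Ψ m A f≤m) ⟨
    l ^ᶠ m · ψ m A f                              ∎

  -- numerator and denominator of the inverse Möbius map  x ↦ (d x - b) / (- c x + a)
  adj-numerator adj-denominator : GL2 → Pol
  adj-numerator   A = linear (-ᶠ GL2.b A) (GL2.d A)
  adj-denominator A = linear (GL2.a A) (-ᶠ GL2.c A)

  Ψ₁-adj-numerator : ∀ A → Ψ 1 (numerator A) (denominator A) (adj-numerator A) ≋ det A · X
  Ψ₁-adj-numerator A = ≋-trans (Ψ₁-linear (numerator A) (denominator A) (-ᶠ b) d)
    (∷-cong (trans (-x*y+y*x≡0 b d) (sym (zeroʳ (det A))))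
            (∷-cong (trans (-b*c+d*a≡ad-bc a b c d) (sym (*-identityʳ (det A)))) ≋-refl))
    where open GL2 A

  Ψ₁-adj-denominator : ∀ A → Ψ 1 (numerator A) (denominator A) (adj-denominator A) ≋ det A · one
  Ψ₁-adj-denominator A = ≋-trans (Ψ₁-linear (numerator A) (denominator A) a (-ᶠ c))
    (∷-cong (trans (a*d+-c*b≡ad-bc a b c d) (sym (*-identityʳ (det A))))
            (≋-trans (∷-cong (trans (+-comm _ _) (-x*y+y*x≡0 c a)) ≋-refl) 0∷[]≋[]))
    where open GL2 A

  ψ-surjective : ∀ m A {h} → Deg≤ h m → ∃ λ r → Deg≤ r m × ψ m A r ≋ h
  ψ-surjective m A {h} h≤m = r , r≤m , (begin
    ψ m A r                                  ≈⟨ ψ≋Ψ m A r≤m ⟩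
    Ψ m L M (δ ^ᶠ m · Ψ m L′ M′ h)           ≈⟨ Ψ-· m L M (δ ^ᶠ m) (Ψ m L′ M′ h) ⟩
    δ ^ᶠ m · Ψ m L M (Ψ m L′ M′ h)           ≈⟨ ·-congʳ (Ψ-∘ (Deg≤-linear _ _) (Deg≤-linear _ _) m h h≤m) ⟩
    δ ^ᶠ m · Ψ m (Ψ 1 L M L′) (Ψ 1 L M M′) h ≈⟨ ·-congʳ (Ψ-cong m h (Ψ₁-adj-numerator A) (Ψ₁-adj-denominator A)) ⟩
    δ ^ᶠ m · Ψ m (Δ · X) (Δ · one) h         ≈⟨ ·-congʳ (Ψ-scale Δ X one m h h≤m) ⟩
    δ ^ᶠ m · (Δ ^ᶠ m · Ψ m X one h)          ≈⟨ ·-congʳ (·-congʳ (Ψ-identity m h h≤m)) ⟩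
    δ ^ᶠ m · (Δ ^ᶠ m · h)                    ≈⟨ ·-assoc (δ ^ᶠ m) (Δ ^ᶠ m) h ⟨
    (δ ^ᶠ m *ᶠ Δ ^ᶠ m) · h                   ≈⟨ ≡⇒≋ (cong (_· h) δ^m*Δ^m≡1) ⟩
    1# · h                                   ≈⟨ ·-identityˡ h ⟩
    h                                        ∎)
    where
    L  = numerator A
    M  = denominator A
    L′ = adj-numerator A
    M′ = adj-denominator A
    Δ  = det A
    δ  = Δ ⁻¹⟨ GL2.det≢0 A ⟩
    r  = δ ^ᶠ m · Ψ m L′ M′ h

    r≤m : Deg≤ r m
    r≤m = Deg≤-· (Deg≤-Ψ m h (Deg≤-linear _ _) (Deg≤-linear _ _) h≤m)

    δ^m*Δ^m≡1 : δ ^ᶠ m *ᶠ Δ ^ᶠ m ≡ 1#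
    δ^m*Δ^m≡1 = trans (sym (^-distrib-* δ Δ m)) (trans (cong (_^ᶠ m) (⁻¹-inverseˡ (GL2.det≢0 A))) (1^n≡1 m))

  ·-cancel : ∀ {c d} → c *ᶠ d ≡ 1# → ∀ p → c · (d · p) ≋ p
  ·-cancel {c} {d} cd≡1 p = ≋-trans (≋-sym (·-assoc c d p)) (≋-trans (≡⇒≋ (cong (_· p) cd≡1)) (·-identityˡ p))

  ·²-⊗ : ∀ c p q → (c *ᶠ c) · (p ⊗ q) ≋ (c · p) ⊗ (c · q)
  ·²-⊗ c p q = ≋-sym (begin
    (c · p) ⊗ (c · q)   ≈⟨ ⊗-·ˡ c p (c · q) ⟩
    c · (p ⊗ (c · q))   ≈⟨ ·-congʳ (⊗-·ʳ c p q) ⟩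
    c · (c · (p ⊗ q))   ≈⟨ ·-assoc c c (p ⊗ q) ⟨
    (c *ᶠ c) · (p ⊗ q)  ∎)

  rescale-isomorphism : ∀ {m k v u v′ u′} → m + m ≡ k → ∀ A {e l} (l≢0 : l ≢ 0#) → l ^ᶠ m *ᶠ e ≡ 1# → ∀ h →
    Deg≤ v m → Deg≤ u k →
    e · v′ ≋ ψ m A v →
    (e *ᶠ e) · u′ ≋ ψ k A u ⊕ h ⊗ h ⊕ ψ m A v ⊗ h →
    v′ ≋ ψ m (l≢0 • A) v × u′ ≋ ψ k (l≢0 • A) u ⊕ (l ^ᶠ m · h) ⊗ (l ^ᶠ m · h) ⊕ v′ ⊗ (l ^ᶠ m · h)
  rescale-isomorphism {m} {v = v} {u} {v′} {u′} refl A {e} {l} l≢0 εe≡1 h v≤m u≤m+m ev′≋ψv eeu′≋ = v′≋ψ′v , u′≋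
    where
    ε = l ^ᶠ m

    v′≋ψ′v : v′ ≋ ψ m (l≢0 • A) v
    v′≋ψ′v = begin
      v′                ≈⟨ ·-cancel εe≡1 v′ ⟨
      ε · (e · v′)      ≈⟨ ·-congʳ ev′≋ψv ⟩
      ε · ψ m A v       ≈⟨ ψ-• m A l≢0 v≤m ⟨
      ψ m (l≢0 • A) v   ∎

    εε*ee≡1 : (ε *ᶠ ε) *ᶠ (e *ᶠ e) ≡ 1#
    εε*ee≡1 = trans (interchange ε ε e e) (trans (cong₂ _*ᶠ_ εe≡1 εe≡1) (*-identityˡ 1#))

    εε·ψu≋ψ′u : (ε *ᶠ ε) · ψ (m + m) A u ≋ ψ (m + m) (l≢0 • A) u
    εε·ψu≋ψ′u = ≋-sym (≋-trans (ψ-• (m + m) A l≢0 u≤m+m) (≡⇒≋ (cong (_· ψ (m + m) A u) (^-homo-* l m m))))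

    u′≋ : u′ ≋ ψ (m + m) (l≢0 • A) u ⊕ (ε · h) ⊗ (ε · h) ⊕ v′ ⊗ (ε · h)
    u′≋ = begin
      u′
        ≈⟨ ·-cancel εε*ee≡1 u′ ⟨
      (ε *ᶠ ε) · ((e *ᶠ e) · u′)
        ≈⟨ ·-congʳ eeu′≋ ⟩
      (ε *ᶠ ε) · (ψ (m + m) A u ⊕ h ⊗ h ⊕ ψ m A v ⊗ h)
        ≈⟨ ≋-trans (·-distribˡ-⊕ (ε *ᶠ ε) (ψ (m + m) A u ⊕ h ⊗ h) (ψ m A v ⊗ h))
                   (⊕-cong (·-distribˡ-⊕ (ε *ᶠ ε) (ψ (m + m) A u) (h ⊗ h)) ≋-refl) ⟩
      (ε *ᶠ ε) · ψ (m + m) A u ⊕ (ε *ᶠ ε) · (h ⊗ h) ⊕ (ε *ᶠ ε) · (ψ m A v ⊗ h)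
        ≈⟨ ⊕-cong (⊕-cong εε·ψu≋ψ′u (·²-⊗ ε h h)) (·²-⊗ ε (ψ m A v) h) ⟩
      ψ (m + m) (l≢0 • A) u ⊕ (ε · h) ⊗ (ε · h) ⊕ (ε · ψ m A v) ⊗ (ε · h)
        ≈⟨ ⊕-cong ≋-refl (⊗-congˡ (ε · h) (≋-trans (·-congʳ (≋-sym ev′≋ψv)) (·-cancel εe≡1 v′))) ⟩
      ψ (m + m) (l≢0 • A) u ⊕ (ε · h) ⊗ (ε · h) ⊕ v′ ⊗ (ε · h)
        ∎

  commute-translation : ∀ {m k v u u′ h} → m + m ≡ k → ∀ A → ψ m A v ≋ v →
    Deg≤ v m → Deg≤ u k → Deg≤ h m →
    u′ ≋ ψ k A u ⊕ h ⊗ h ⊕ v ⊗ h →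
    ∃ λ r → Deg≤ r m × u′ ≋ ψ k A (u ⊕ r ⊗ r ⊕ v ⊗ r)
  commute-translation {m} {v = v} {u} {u′} {h} refl A ψv≋v v≤m u≤m+m h≤m u′≋ with ψ-surjective m A h≤m
  ... | r , r≤m , ψr≋h = r , r≤m , (begin
    u′
      ≈⟨ u′≋ ⟩
    ψ (m + m) A u ⊕ h ⊗ h ⊕ v ⊗ h
      ≈⟨ ⊕-cong (⊕-cong ≋-refl (⊗-cong ψr≋h ψr≋h)) (⊗-cong ψv≋v ψr≋h) ⟨
    ψ (m + m) A u ⊕ ψ m A r ⊗ ψ m A r ⊕ ψ m A v ⊗ ψ m A r
      ≈⟨ ⊕-cong (⊕-cong ≋-refl (ψ-⊗ m m A r≤m r≤m)) (ψ-⊗ m m A v≤m r≤m) ⟨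
    ψ (m + m) A u ⊕ ψ (m + m) A (r ⊗ r) ⊕ ψ (m + m) A (v ⊗ r)
      ≈⟨ ⊕-cong (ψ-⊕ (m + m) A u≤m+m (Deg≤-⊗ r≤m r≤m)) ≋-refl ⟨
    ψ (m + m) A (u ⊕ r ⊗ r) ⊕ ψ (m + m) A (v ⊗ r)
      ≈⟨ ψ-⊕ (m + m) A (Deg≤-⊕ u≤m+m (Deg≤-⊗ r≤m r≤m)) (Deg≤-⊗ v≤m r≤m) ⟨
    ψ (m + m) A (u ⊕ r ⊗ r ⊕ v ⊗ r)
      ∎)
lemma4p4 : (g n : ℕ) → 1 ≤ g → 1 ≤ n → gcd (suc g) (2 ^ n ∸ 1) ≡ 1 →
    (F : GF2^ n) → let open Poly F in
    (v u₁ u₂ : Pol) →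
    DegCond g v u₁ → DegCond g v u₂ →
    Isomorphic g v u₁ v u₂ →
    Σ GL2 λ A → Σ Pol λ r →
      Stab g v A × DegLe r (suc g)
      × u₂ ≈ₚ ψ (suc (suc (g + g))) A (u₁ ⊕ (r ⊗ r) ⊕ (v ⊗ r))
lemma4p4 g n _ _ gcd≡1 F v u₁ u₂ (v≤1+g , u₁≤2+2g , _) _ (A , e , h , e≢0 , h≤1+g , ev≈ψv , eeu₂≈) =
  let open FiniteField F
      open Polynomial F
      open PolynomialSubstitution F
      2[1+g]≡2+2g = cong suc (ℕ.+-suc g g)
      (l , l^[1+g]e≡1) = root-of-inverse (suc g) gcd≡1 e≢0
      l≢0 = x^[1+k]*y≡1⇒x≢0 g l^[1+g]e≡1
      (v≋ψ′v , u₂≋) = rescale-isomorphism {v′ = v} {u₂} 2[1+g]≡2+2g A l≢0 l^[1+g]e≡1 h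
                        (DegLe⇒Deg≤ v≤1+g) (DegLe⇒Deg≤ u₁≤2+2g) (≈ₚ⇒≋ ev≈ψv) (≈ₚ⇒≋ eeu₂≈)
      (r , r≤1+g , u₂≋ψ′[u₁+r²+vr]) = commute-translation 2[1+g]≡2+2g (l≢0 • A) (≋-sym v≋ψ′v)
                        (DegLe⇒Deg≤ v≤1+g) (DegLe⇒Deg≤ u₁≤2+2g) (Deg≤-· (DegLe⇒Deg≤ h≤1+g)) u₂≋
  in l≢0 • A , r , ≋⇒≈ₚ (≋-sym v≋ψ′v) , Deg≤⇒DegLe r≤1+g , ≋⇒≈ₚ u₂≋ψ′[u₁+r²+vr]
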